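{- Let $n\ge 1$, $V=\{1,\dots,n\}$, and let $\tau$ be the cyclic permutation of $V$ with $\tau(1)=n$ and $\tau(i)=i-1$ for $2\le i\le n$. Equip $\mathbb{Z}^n$ with the multiplication $$(a_1,\dots,a_n)*(b_1,\dots,b_n)=\big(a_1+b_{\tau^{a_1}(1)},\,\dots,\,a_n+b_{\tau^{a_n}(n)}\big),$$ where $\tau^{a}(i)$ is the unique element of $\{1,\dots,n\}$ congruent to $i-a$ modulo $n$, and let $\mathfrak{A}_n$ be the group of invertible elements of the monoid $(\mathbb{Z}^n,*)$. Then $\mathfrak{A}_n$ is isomorphic to the semidirect product $\mathbb{Z}^n\rtimes S_n$, where the symmetric group $S_n$ acts on $\mathbb{Z}^n$ by permuting the coordinates.
   Context: The multiplication $*$ is associative with identity $(0,\dots,0)$; it arises from the right action $v\cdot k=\tau^k(v)$ of $\mathbb{Z}$ on $V$ via $(\phi_2*\phi_1)(v)=\phi_2(v)+\phi_1(v\cdot\phi_2(v))$ on maps $V\to\mathbb{Z}$. -}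

module Defs where

open import Data.Nat using (ℕ; NonZero)
open import Data.Integer using (ℤ; +_; _+_; _-_; 0ℤ; _%ℕ_)
open import Data.Integer.DivMod using (n%ℕd<d)
open import Data.Fin using (Fin; toℕ; fromℕ<)
open import Data.Fin.Permutation using (Permutation′; _⟨$⟩ʳ_; _⟨$⟩ˡ_; _∘ₚ_)
open import Data.Product using (Σ; ∃; _×_; _,_)
open import Relation.Binary.PropositionalEquality using (_≡_)

-- Coordinates are 0-indexed: index i : Fin n stands for the element i+1 of V = {1,…,n}.

-- τ^a (i) : the unique element of V congruent to i - a modulo n.
-- (With 0-indexing this is (i - a) mod n, the shift by 1 being harmless.)
tauPow : (n : ℕ) .{{_ : NonZero n}} → ℤ → Fin n → Fin n
tauPow n a i = fromℕ< (n%ℕd<d ((+ toℕ i) - a) n)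

Zn : ℕ → Set
Zn n = Fin n → ℤ

_≈_ : {n : ℕ} → Zn n → Zn n → Set
a ≈ b = ∀ i → a i ≡ b i

mul : (n : ℕ) .{{_ : NonZero n}} → Zn n → Zn n → Zn n
mul n a b i = a i + b (tauPow n (a i) i)

one : (n : ℕ) → Zn n
one n i = 0ℤ

IsUnit : (n : ℕ) .{{_ : NonZero n}} → Zn n → Set
IsUnit n a = ∃ λ b → (mul n a b ≈ one n) × (mul n b a ≈ one n)

-- The semidirect product ℤ^n ⋊ S_n, with S_n acting on ℤ^n by permuting
-- coordinates: (σ · w)_i = w_{σ⁻¹(i)}.
SD : ℕ → Set
SD n = Zn n × Permutation′ n

_≈SD_ : {n : ℕ} → SD n → SD n → Set
(v , σ) ≈SD (w , π) = (v ≈ w) × (∀ i → σ ⟨$⟩ʳ i ≡ π ⟨$⟩ʳ i)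

act : {n : ℕ} → Permutation′ n → Zn n → Zn n
act σ w i = w (σ ⟨$⟩ˡ i)

-- (v , σ) · (w , π) = (v + σ·w , σ ∘ π)   where (σ ∘ π)(i) = σ(π(i))
mulSD : {n : ℕ} → SD n → SD n → SD n
mulSD (v , σ) (w , π) = (λ i → v i + act σ w i) , (π ∘ₚ σ)

-- A group isomorphism from the unit group 𝔄_n (units of (ℤ^n, *), with
-- equality and multiplication inherited from ℤ^n) onto ℤ^n ⋊ S_n, presented
-- as a map on units (independent of the unit witness) that is
-- well-defined, multiplicative, injective and surjective.
record UnitGroupIso (n : ℕ) .{{nz : NonZero n}} : Set where
  field
    f          : (a : Zn n) → IsUnit n a → SD n
    f-cong     : ∀ a b (p : IsUnit n a) (q : IsUnit n b) → a ≈ b → f a p ≈SD f b q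
    f-hom      : ∀ a b (p : IsUnit n a) (q : IsUnit n b) (r : IsUnit n (mul n a b)) →
                 f (mul n a b) r ≈SD mulSD (f a p) (f b q)
    f-injective : ∀ a b (p : IsUnit n a) (q : IsUnit n b) → f a p ≈SD f b q → a ≈ b
    f-surjective : ∀ s → Σ (Zn n) λ a → Σ (IsUnit n a) λ p → f a p ≈SD s

-- Write i − a_i = σ_a(i) + k_a(i)·n with 0 ≤ σ_a(i) < n, i.e. σ_a(i) = τ^{a_i}(i).
-- The pair (k_a, σ_a) determines a, and in these coordinates the product becomes
-- (k, σ) * (k′, σ′) = (k + k′ ∘ σ, σ′ ∘ σ): the monoid (ℤⁿ, *) is ℤⁿ ⋊ End(V).
-- Its units are exactly the pairs with σ bijective, i.e. ℤⁿ ⋊ S_n.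
module Submission where

open import Defs
open import Data.Nat using (ℕ; NonZero)
import Data.Nat as ℕ
open import Data.Integer using (ℤ; +_; _+_; _-_; _*_; -_; 0ℤ; _%ℕ_; _/ℕ_; _≤_; _<_; +<+)
open import Data.Integer.Properties
  using (+-injective; +-monoˡ-<; i≤j+i; ≤-<-trans; ≤-antisym; pred-suc; i<j⇒i≤pred[j];
         *-cancelʳ-<-nonNeg; +-inverseˡ; +-inverseʳ; +-0-abelianGroup)
open import Algebra.Properties.AbelianGroup +-0-abelianGroup using (∙-cancelʳ)
open import Data.Integer.DivMod using (n%ℕd<d; a≡a%ℕn+[a/ℕn]*n)
open import Data.Integer.Tactic.RingSolver using (solve-∀)
open import Data.Fin using (Fin; toℕ)
open import Data.Fin.Properties using (toℕ-fromℕ<; toℕ-injective; toℕ<n)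
open import Data.Fin.Permutation using (Permutation′; _⟨$⟩ʳ_; _⟨$⟩ˡ_; permutation; inverseˡ; inverseʳ)
open import Data.Product using (Σ; _×_; _,_; proj₁; proj₂)
open import Function using (_∘_; id)
open import Relation.Binary.PropositionalEquality

quotient-≤ : ∀ n .{{_ : NonZero n}} {q q′ r r′} →
             r′ ℕ.< n → + r + q * + n ≡ + r′ + q′ * + n → q ≤ q′
quotient-≤ n {q} {q′} {r} {r′} r′<n eq =
  subst (q ≤_) (pred-suc q′)
        (i<j⇒i≤pred[j] (*-cancelʳ-<-nonNeg {q} {+ 1 + q′} (+ n) qn<[1+q′]n))
  where
  [1+q′]N : ∀ q′ N → N + q′ * N ≡ (+ 1 + q′) * N
  [1+q′]N = solve-∀
  qn<[1+q′]n : q * + n < (+ 1 + q′) * + n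
  qn<[1+q′]n = ≤-<-trans (i≤j+i (q * + n) (+ r))
    (subst₂ _<_ (sym eq) ([1+q′]N q′ (+ n)) (+-monoˡ-< (q′ * + n) (+<+ r′<n)))

divMod-unique : ∀ n .{{_ : NonZero n}} {x q r} →
                r ℕ.< n → x ≡ + r + q * + n → x %ℕ n ≡ r × x /ℕ n ≡ q
divMod-unique n {x} {q} {r} r<n eq = remainder , quotient
  where
  split : + (x %ℕ n) + (x /ℕ n) * + n ≡ + r + q * + n
  split = trans (sym (a≡a%ℕn+[a/ℕn]*n x n)) eq
  quotient : x /ℕ n ≡ q
  quotient = ≤-antisym (quotient-≤ n r<n split) (quotient-≤ n (n%ℕd<d x n) (sym split))
  remainder : x %ℕ n ≡ r
  remainder = +-injective (∙-cancelʳ (q * + n) _ _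
    (subst (λ q″ → + (x %ℕ n) + q″ * + n ≡ + r + q * + n) quotient split))

module _ (n : ℕ) .{{_ : NonZero n}} where

  shift : Zn n → Fin n → Fin n
  shift a i = tauPow n (a i) i

  winding : Zn n → Fin n → ℤ
  winding a i = (+ toℕ i - a i) /ℕ n

  encode : (Fin n → ℤ) → (Fin n → Fin n) → Zn n
  encode k σ i = + toℕ i - + toℕ (σ i) - k i * + n

  twistedSum : (Fin n → ℤ) → (Fin n → Fin n) → (Fin n → ℤ) → Fin n → ℤ
  twistedSum k σ k′ i = k i + k′ (σ i)

  shift-cong : ∀ a b i → a i ≡ b i → shift a i ≡ shift b i
  shift-cong a b i = cong (λ x → tauPow n x i)

  winding-cong : ∀ a b i → a i ≡ b i → winding a i ≡ winding b i
  winding-cong a b i = cong (λ x → (+ toℕ i - x) /ℕ n)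

  mul-cong : ∀ a a′ b b′ → a ≈ a′ → b ≈ b′ → mul n a b ≈ mul n a′ b′
  mul-cong a a′ b b′ a≈a′ b≈b′ i rewrite a≈a′ i = cong (_+_ (a′ i)) (b≈b′ _)

  encode-shift-winding : ∀ a → a ≈ encode (winding a) (shift a)
  encode-shift-winding a i = begin
    a i
      ≡⟨ sym (I-[I-x] I (a i)) ⟩
    I - (I - a i)
      ≡⟨ cong (_-_ I) (a≡a%ℕn+[a/ℕn]*n (I - a i) n) ⟩
    I - (+ ((I - a i) %ℕ n) + winding a i * + n)
      ≡⟨ I-[R+K] I (+ ((I - a i) %ℕ n)) (winding a i * + n) ⟩
    I - + ((I - a i) %ℕ n) - winding a i * + n
      ≡⟨ cong (λ r → I - + r - winding a i * + n) (sym (toℕ-fromℕ< (n%ℕd<d (I - a i) n))) ⟩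
    encode (winding a) (shift a) i
      ∎
    where
    open ≡-Reasoning
    I : ℤ
    I = + toℕ i
    I-[I-x] : ∀ I x → I - (I - x) ≡ x
    I-[I-x] = solve-∀
    I-[R+K] : ∀ I R K → I - (R + K) ≡ I - R - K
    I-[R+K] = solve-∀

  divMod-encode : ∀ k σ i →
                  (+ toℕ i - encode k σ i) %ℕ n ≡ toℕ (σ i) × winding (encode k σ) i ≡ k i
  divMod-encode k σ i =
    divMod-unique n (toℕ<n (σ i)) (I-[I-J-K] (+ toℕ i) (+ toℕ (σ i)) (k i * + n))
    where
    I-[I-J-K] : ∀ I J K → I - (I - J - K) ≡ J + K
    I-[I-J-K] = solve-∀

  shift-encode : ∀ k σ i → shift (encode k σ) i ≡ σ i
  shift-encode k σ i = toℕ-injective (trans (toℕ-fromℕ< _) (proj₁ (divMod-encode k σ i)))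

  winding-encode : ∀ k σ i → winding (encode k σ) i ≡ k i
  winding-encode k σ i = proj₂ (divMod-encode k σ i)

  encode-cong : ∀ k k′ σ σ′ i → k i ≡ k′ i → σ i ≡ σ′ i → encode k σ i ≡ encode k′ σ′ i
  encode-cong k k′ σ σ′ i = cong₂ (λ x j → + toℕ i - + toℕ j - x * + n)

  mul-encode : ∀ k σ k′ σ′ →
               mul n (encode k σ) (encode k′ σ′) ≈ encode (twistedSum k σ k′) (σ′ ∘ σ)
  mul-encode k σ k′ σ′ i = begin
    encode k σ i + encode k′ σ′ (shift (encode k σ) i)
      ≡⟨ cong (λ j → encode k σ i + encode k′ σ′ j) (shift-encode k σ i) ⟩
    encode k σ i + encode k′ σ′ (σ i)
      ≡⟨ telescope (+ toℕ i) (+ toℕ (σ i)) (+ toℕ (σ′ (σ i))) (k i) (k′ (σ i)) (+ n) ⟩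
    encode (twistedSum k σ k′) (σ′ ∘ σ) i
      ∎
    where
    open ≡-Reasoning
    telescope : ∀ I J L K K′ N → (I - J - K * N) + (J - L - K′ * N) ≡ I - L - (K + K′) * N
    telescope = solve-∀

  mul-decomposed : ∀ a b →
                   mul n a b ≈ encode (twistedSum (winding a) (shift a) (winding b)) (shift b ∘ shift a)
  mul-decomposed a b i =
    trans (mul-cong a (encode (winding a) (shift a)) b (encode (winding b) (shift b))
                    (encode-shift-winding a) (encode-shift-winding b) i)
          (mul-encode (winding a) (shift a) (winding b) (shift b) i)

  coordinates : ∀ a k σ → a ≈ encode k σ → ∀ i → shift a i ≡ σ i × winding a i ≡ k i
  coordinates a k σ a≈kσ i =
    trans (shift-cong a (encode k σ) i (a≈kσ i)) (shift-encode k σ i) ,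
    trans (winding-cong a (encode k σ) i (a≈kσ i)) (winding-encode k σ i)

  coordinates-mul : ∀ a b i → shift (mul n a b) i ≡ shift b (shift a i)
                              × winding (mul n a b) i ≡ twistedSum (winding a) (shift a) (winding b) i
  coordinates-mul a b =
    coordinates (mul n a b) (twistedSum (winding a) (shift a) (winding b)) (shift b ∘ shift a)
                (mul-decomposed a b)

  one-encode : one n ≈ encode (λ _ → 0ℤ) id
  one-encode i = sym (I-I-0 (+ toℕ i) (+ n))
    where
    I-I-0 : ∀ I N → I - I - 0ℤ * N ≡ 0ℤ
    I-I-0 = solve-∀

  shift-one : ∀ i → shift (one n) i ≡ i
  shift-one = proj₁ ∘ coordinates (one n) (λ _ → 0ℤ) id one-encode

  shift-inverse : ∀ a b → mul n a b ≈ one n → ∀ i → shift b (shift a i) ≡ i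
  shift-inverse a b ab≈1 i = begin
    shift b (shift a i)  ≡⟨ sym (proj₁ (coordinates-mul a b i)) ⟩
    shift (mul n a b) i  ≡⟨ shift-cong (mul n a b) (one n) i (ab≈1 i) ⟩
    shift (one n) i      ≡⟨ shift-one i ⟩
    i                    ∎
    where open ≡-Reasoning

  shift-inverse-unique : ∀ a b → mul n a b ≈ one n → (g : Fin n → Fin n) →
                         (∀ i → shift a (g i) ≡ i) → ∀ i → shift b i ≡ g i
  shift-inverse-unique a b ab≈1 g ag≡id i =
    trans (cong (shift b) (sym (ag≡id i))) (shift-inverse a b ab≈1 (g i))

  encode-unit : ∀ k σ k′ σ′ → (∀ i → twistedSum k σ k′ i ≡ 0ℤ) → (∀ i → σ′ (σ i) ≡ i) →
                mul n (encode k σ) (encode k′ σ′) ≈ one n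
  encode-unit k σ k′ σ′ k+k′σ≡0 σ′σ≡id i =
    trans (mul-encode k σ k′ σ′ i)
          (trans (encode-cong (twistedSum k σ k′) (λ _ → 0ℤ) (σ′ ∘ σ) id i
                              (k+k′σ≡0 i) (σ′σ≡id i))
                 (sym (one-encode i)))

  -- σ_a goes in the ⟨$⟩ˡ direction so that act (shiftPermutation a p) k = k ∘ σ_a.
  shiftPermutation : ∀ a → IsUnit n a → Permutation′ n
  shiftPermutation a (b , ab≈1 , ba≈1) =
    permutation (shift b) (shift a) (shift-inverse a b ab≈1) (shift-inverse b a ba≈1)

  toSemidirect : (a : Zn n) → IsUnit n a → SD n
  toSemidirect a p = winding a , shiftPermutation a p

  toSemidirect-cong : ∀ a b (p : IsUnit n a) (q : IsUnit n b) → a ≈ b →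
                      toSemidirect a p ≈SD toSemidirect b q
  toSemidirect-cong a b (a⁻¹ , aa⁻¹≈1 , _) (b⁻¹ , _ , b⁻¹b≈1) a≈b =
    (λ i → winding-cong a b i (a≈b i)) ,
    shift-inverse-unique a a⁻¹ aa⁻¹≈1 (shift b⁻¹)
      (λ i → trans (shift-cong a b _ (a≈b _)) (shift-inverse b⁻¹ b b⁻¹b≈1 i))

  toSemidirect-hom : ∀ a b (p : IsUnit n a) (q : IsUnit n b) (r : IsUnit n (mul n a b)) →
                     toSemidirect (mul n a b) r ≈SD mulSD (toSemidirect a p) (toSemidirect b q)
  toSemidirect-hom a b (a⁻¹ , _ , a⁻¹a≈1) (b⁻¹ , _ , b⁻¹b≈1) ([ab]⁻¹ , ab[ab]⁻¹≈1 , _) =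
    proj₂ ∘ coordinates-mul a b ,
    shift-inverse-unique (mul n a b) [ab]⁻¹ ab[ab]⁻¹≈1 (shift a⁻¹ ∘ shift b⁻¹)
      (λ i → trans (proj₁ (coordinates-mul a b _))
                   (trans (cong (shift b) (shift-inverse a⁻¹ a a⁻¹a≈1 _))
                          (shift-inverse b⁻¹ b b⁻¹b≈1 i)))

  toSemidirect-injective : ∀ a b (p : IsUnit n a) (q : IsUnit n b) →
                           toSemidirect a p ≈SD toSemidirect b q → a ≈ b
  toSemidirect-injective a b (a⁻¹ , _ , a⁻¹a≈1) (b⁻¹ , bb⁻¹≈1 , _) (kₐ≡k_b , a⁻¹≡b⁻¹) i =
    trans (encode-shift-winding a i)
          (trans (encode-cong (winding a) (winding b) (shift a) (shift b) i
                              (kₐ≡k_b i) (σₐ≡σ_b i))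
                 (sym (encode-shift-winding b i)))
    where
    σₐ≡σ_b : ∀ i → shift a i ≡ shift b i
    σₐ≡σ_b = shift-inverse-unique a⁻¹ a a⁻¹a≈1 (shift b)
      (λ j → trans (a⁻¹≡b⁻¹ (shift b j)) (shift-inverse b b⁻¹ bb⁻¹≈1 j))

  toSemidirect-surjective : ∀ s → Σ (Zn n) λ a → Σ (IsUnit n a) λ p → toSemidirect a p ≈SD s
  toSemidirect-surjective (k , π) =
    encode k σ ,
    (encode k′ σ⁻¹ , encode-unit k σ k′ σ⁻¹ k+k′σ≡0 (λ _ → inverseʳ π)
                   , encode-unit k′ σ⁻¹ k σ k′+kσ⁻¹≡0 (λ _ → inverseˡ π)) ,
    winding-encode k σ , shift-encode k′ σ⁻¹
    where
    σ σ⁻¹ : Fin n → Fin n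
    σ = π ⟨$⟩ˡ_
    σ⁻¹ = π ⟨$⟩ʳ_
    k′ : Fin n → ℤ
    k′ j = - k (σ⁻¹ j)
    k+k′σ≡0 : ∀ i → twistedSum k σ k′ i ≡ 0ℤ
    k+k′σ≡0 i = trans (cong (λ j → k i + - k j) (inverseʳ π)) (+-inverseʳ (k i))
    k′+kσ⁻¹≡0 : ∀ i → twistedSum k′ σ⁻¹ k i ≡ 0ℤ
    k′+kσ⁻¹≡0 i = +-inverseˡ (k (σ⁻¹ i))

mainTheorem3 : (n : ℕ) .{{_ : NonZero n}} → UnitGroupIso n
mainTheorem3 n = record
  { f            = toSemidirect n
  ; f-cong       = toSemidirect-cong n
  ; f-hom        = toSemidirect-hom n
  ; f-injective  = toSemidirect-injective n
  ; f-surjective = toSemidirect-surjective n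
  }
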